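{- Let $(V,F)$ be a commutative near vector space with finite block type, $V=\bigoplus_{i=1}^m B_i$. Then every ultrapower $\prod V/\mathcal U$ of $V$, viewed as an $\mathcal L_{Fnvs}$-structure, is a near vector space over $F$.
   Context: An $F$-group is a pair $(V,F)$ where $(V,+)$ is a group, $F$ is a set of endomorphisms of $V$ containing the zero map $0$, the identity $1$ and the negation map $-1$, $F\setminus\{0\}$ is a subgroup of the automorphism group of $(V,+)$, and $F$ acts fixed-point-freely: if $\alpha x=\beta x$ with $\alpha,\beta\in F$, $x\in V$, then $\alpha=\beta$ or $x=0$. The quasi-kernel $Q(V)$ is the set of $u\in V$ such that for every $\alpha,\beta\in F$ there is $\gamma\in F$ with $\alpha u+\beta u=\gamma u$. $(V,F)$ is a near vector space if $Q(V)$ generates $(V,+)$; it is commutative if $\alpha(\beta(v))=\beta(\alpha(v))$ for all $\alpha,\beta\in F$, $v\in V$. Elements $u,v\in Q(V)\setminus\{0\}$ are compatible if $u+\lambda v\in Q(V)$ for some $\lambda\in F\setminus\{0\}$; this is an equivalence relation, and $V$ decomposes as a direct sum of blocks (maximal regular near vector subspaces, one for each compatibility class, each nonzero element of $Q(V)$ lying in exactly one block). $V$ has finite block type if it has finitely many blocks. $\mathcal L_{Fnvs}=\{+,0,(\lambda)_{\lambda\in F}\}$, where each $\lambda$ is a unary function symbol interpreted as the action of $\lambda$; the ultrapower carries the induced action of each $\lambda\in F$. -}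

module Defs where

open import Level using (0ℓ)
open import Algebra.Bundles using (Group)
open import Data.Product using (Σ; ∃; _×_; _,_)
open import Data.Sum using (_⊎_)
open import Data.Unit using (⊤; tt)
open import Data.Nat using (ℕ)
open import Data.Fin using (Fin)
open import Data.List using (List; foldr)
open import Data.List.Relation.Unary.All using (All)
open import Relation.Binary.PropositionalEquality using (_≡_; _≢_)
open import Relation.Nullary using (¬_)

-- Ultrafilters on an index type I (subsets of I are predicates I → Set).
-- Properness is stated as "every set in U is inhabited" (classically the
-- same as "∅ ∉ U" given upward closure).

record Ultrafilter (I : Set) : Set₁ where
  field
    U        : (I → Set) → Set
    U-full   : U (λ _ → ⊤)
    U-proper : ∀ {A} → U A → Σ I A
    U-mono   : ∀ {A B : I → Set} → (∀ i → A i → B i) → U A → U B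
    U-∩      : ∀ {A B : I → Set} → U A → U B → U (λ i → A i × B i)
    U-ultra  : ∀ (A : I → Set) → U A ⊎ U (λ i → ¬ A i)

-- F is given as an index type Φ together with its (injective) action
-- act : Φ → V → V; 𝟘, 𝟙, m𝟙 are the zero map, identity, and negation.

module NVS (G : Group 0ℓ 0ℓ) where
  open Group G

  record IsFGroup (Φ : Set) (act : Φ → Carrier → Carrier) (𝟘 𝟙 m𝟙 : Φ) : Set where
    field
      act-cong   : ∀ α {x y} → x ≈ y → act α x ≈ act α y
      act-hom    : ∀ α x y → act α (x ∙ y) ≈ (act α x ∙ act α y)
      act-inj    : ∀ α β → (∀ x → act α x ≈ act β x) → α ≡ β
      act-𝟘      : ∀ x → act 𝟘 x ≈ ε
      act-𝟙      : ∀ x → act 𝟙 x ≈ x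
      act-m𝟙     : ∀ x → act m𝟙 x ≈ (x ⁻¹)
      𝟙≢𝟘        : 𝟙 ≢ 𝟘
      -- F ∖ {0} is a subgroup of Aut(V,+): closed under composition
      -- and (two-sided) inverses; hence each nonzero α is an automorphism.
      comp       : ∀ α β → α ≢ 𝟘 → β ≢ 𝟘 →
                   ∃ λ γ → γ ≢ 𝟘 × (∀ x → act γ x ≈ act α (act β x))
      inv        : ∀ α → α ≢ 𝟘 →
                   ∃ λ β → β ≢ 𝟘 × (∀ x → act β (act α x) ≈ x)
                                 × (∀ x → act α (act β x) ≈ x)
      fpf        : ∀ α β x → act α x ≈ act β x → α ≡ β ⊎ x ≈ ε

  InQ : {Φ : Set} → (Φ → Carrier → Carrier) → Carrier → Set
  InQ {Φ} act u = ∀ (α β : Φ) → ∃ λ γ → (act α u ∙ act β u) ≈ act γ u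

  Generates : (Carrier → Set) → Set
  Generates P = ∀ v → ∃ λ (xs : List Carrier) →
                  All (λ x → P x ⊎ P (x ⁻¹)) xs × foldr _∙_ ε xs ≈ v

  record IsNearVectorSpace (Φ : Set) (act : Φ → Carrier → Carrier) (𝟘 𝟙 m𝟙 : Φ) : Set where
    field
      isFGroup  : IsFGroup Φ act 𝟘 𝟙 m𝟙
      generated : Generates (InQ act)

  IsCommutative : {Φ : Set} → (Φ → Carrier → Carrier) → Set
  IsCommutative act = ∀ α β v → act α (act β v) ≈ act β (act α v)

  Compatible : {Φ : Set} → (Φ → Carrier → Carrier) → Φ → Carrier → Carrier → Set
  Compatible act 𝟘 u v =
    (InQ act u × ¬ u ≈ ε) × (InQ act v × ¬ v ≈ ε) ×
    ∃ λ l → l ≢ 𝟘 × InQ act (u ∙ act l v)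

  -- V has exactly m blocks: there are m pairwise incompatible nonzero
  -- quasi-kernel elements u 1..u m such that every nonzero element of Q(V)
  -- is compatible with one of them (blocks ↔ compatibility classes).
  HasBlocks : {Φ : Set} → (Φ → Carrier → Carrier) → Φ → ℕ → Set
  HasBlocks act 𝟘 m =
    ∃ λ (u : Fin m → Carrier) →
      (∀ i → InQ act (u i) × ¬ u i ≈ ε) ×
      (∀ i j → Compatible act 𝟘 (u i) (u j) → i ≡ j) ×
      (∀ q → InQ act q → ¬ q ≈ ε → ∃ λ i → Compatible act 𝟘 q (u i))

module Ultrapower (G : Group 0ℓ 0ℓ) {I : Set} (𝓤 : Ultrafilter I) where
  open Group G
  open Ultrafilter 𝓤

  private
    everywhere : ∀ {A : I → Set} → (∀ i → A i) → U A
    everywhere h = U-mono (λ i _ → h i) U-full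

  _≈ᵁ_ : (I → Carrier) → (I → Carrier) → Set
  f ≈ᵁ g = U (λ i → f i ≈ g i)

  group : Group 0ℓ 0ℓ
  group = record
    { Carrier = I → Carrier
    ; _≈_ = _≈ᵁ_
    ; _∙_ = λ f g i → f i ∙ g i
    ; ε = λ _ → ε
    ; _⁻¹ = λ f i → f i ⁻¹
    ; isGroup = record
      { isMonoid = record
        { isSemigroup = record
          { isMagma = record
            { isEquivalence = record
              { refl = everywhere (λ i → refl)
              ; sym = U-mono (λ i → sym)
              ; trans = λ p q → U-mono (λ { i (a , b) → trans a b }) (U-∩ p q)
              }
            ; ∙-cong = λ p q → U-mono (λ { i (a , b) → ∙-cong a b }) (U-∩ p q)
            }
          ; assoc = λ f g h → everywhere (λ i → assoc (f i) (g i) (h i))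
          }
        ; identity = (λ f → everywhere (λ i → identityˡ (f i)))
                   , (λ f → everywhere (λ i → identityʳ (f i)))
        }
      ; inverse = (λ f → everywhere (λ i → inverseˡ (f i)))
                , (λ f → everywhere (λ i → inverseʳ (f i)))
      ; ⁻¹-cong = U-mono (λ i → ⁻¹-cong)
      }
    }

  liftAct : {Φ : Set} → (Φ → Carrier → Carrier) → Φ → (I → Carrier) → (I → Carrier)
  liftAct act l f i = act l (f i)

module Submission where

-- Negation is an endomorphism, so (V,+) is abelian.  If u is compatible with v, say
-- w = u + l v ∈ Q(V), then every sum relation α v + β v = γ v of v also holds for u, so all
-- elements of a block obey one addition table α ⊕ β of F.  As Q(V) generates V and there are
-- m blocks, every v ∈ V is a sum w₁ + ⋯ + w_m with w_j obeying the table of block j.  Doing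
-- this in each coordinate of f ∈ V^I gives m sequences lying in the quasi-kernel of the
-- ultrapower, because the witness α ⊕_j β is the same in every coordinate; they sum to f.
-- The F-group axioms pass to the ultrapower coordinatewise.  Excluded middle, needed for
-- the case distinctions, follows from the existence of an ultrafilter.

open import Defs
open import Level using (0ℓ)
open import Algebra.Bundles using (Group; AbelianGroup)
open import Axiom.ExcludedMiddle using (ExcludedMiddle)
open import Data.Empty using (⊥-elim)
open import Data.Nat using (ℕ; zero; suc)
open import Data.Fin using (Fin; zero; suc)
open import Data.Fin.Properties using (_≟_)
open import Data.List using ([]; _∷_; foldr; tabulate)
open import Data.List.Relation.Unary.All using (All; []; _∷_)
open import Data.List.Relation.Unary.All.Properties using (tabulate⁺)
open import Data.Product using (Σ; ∃; _×_; _,_; proj₁; proj₂)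
open import Data.Sum using (_⊎_; inj₁; inj₂)
open import Data.Vec.Functional using (Vector; replicate; updateAt)
open import Data.Vec.Functional.Properties using (updateAt-updates; updateAt-minimal)
open import Function using (const)
open import Relation.Nullary using (¬_; Dec; yes; no)
open import Relation.Binary.PropositionalEquality using (_≡_; _≢_)
import Relation.Binary.PropositionalEquality as ≡

module UltrafilterProperties {I : Set} (𝓤 : Ultrafilter I) where
  open Ultrafilter 𝓤

  U-everywhere : ∀ {A : I → Set} → (∀ i → A i) → U A
  U-everywhere A-everywhere = U-mono (λ i _ → A-everywhere i) U-full

  excludedMiddle : ExcludedMiddle 0ℓ
  excludedMiddle {P} with U-ultra (λ _ → P)
  ... | inj₁ U-P  = yes (proj₂ (U-proper U-P))
  ... | inj₂ U-¬P = no (proj₂ (U-proper U-¬P))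

module FGroupProperties
  {G : Group 0ℓ 0ℓ} {Φ : Set} {act : Φ → Group.Carrier G → Group.Carrier G} {𝟘 𝟙 m𝟙 : Φ}
  (isFGroup : NVS.IsFGroup G Φ act 𝟘 𝟙 m𝟙) where

  open Group G
  open NVS G
  open IsFGroup isFGroup
  open import Algebra.Properties.Group G
  open import Relation.Binary.Reasoning.Setoid setoid

  SumRel : Carrier → Φ → Φ → Φ → Set
  SumRel v α β γ = act α v ∙ act β v ≈ act γ v

  ⁻¹-homo-∙ : ∀ x y → (x ∙ y) ⁻¹ ≈ x ⁻¹ ∙ y ⁻¹
  ⁻¹-homo-∙ x y = begin
    (x ∙ y) ⁻¹           ≈⟨ act-m𝟙 (x ∙ y) ⟨
    act m𝟙 (x ∙ y)       ≈⟨ act-hom m𝟙 x y ⟩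
    act m𝟙 x ∙ act m𝟙 y  ≈⟨ ∙-cong (act-m𝟙 x) (act-m𝟙 y) ⟩
    x ⁻¹ ∙ y ⁻¹          ∎

  ∙-comm : ∀ x y → x ∙ y ≈ y ∙ x
  ∙-comm x y = begin
    x ∙ y                  ≈⟨ ⁻¹-involutive (x ∙ y) ⟨
    (x ∙ y) ⁻¹ ⁻¹          ≈⟨ ⁻¹-cong (⁻¹-anti-homo-∙ x y) ⟩
    (y ⁻¹ ∙ x ⁻¹) ⁻¹       ≈⟨ ⁻¹-homo-∙ (y ⁻¹) (x ⁻¹) ⟩
    y ⁻¹ ⁻¹ ∙ x ⁻¹ ⁻¹      ≈⟨ ∙-cong (⁻¹-involutive y) (⁻¹-involutive x) ⟩
    y ∙ x                  ∎

  abelianGroup : AbelianGroup 0ℓ 0ℓ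
  abelianGroup = record { isAbelianGroup = record { isGroup = isGroup ; comm = ∙-comm } }

  act-ε : ∀ α → act α ε ≈ ε
  act-ε α = ∙-cancelˡ (act α ε) (act α ε) ε (begin
    act α ε ∙ act α ε  ≈⟨ act-hom α ε ε ⟨
    act α (ε ∙ ε)      ≈⟨ act-cong α (identityʳ ε) ⟩
    act α ε            ≈⟨ identityʳ (act α ε) ⟨
    act α ε ∙ ε        ∎)

  act-⁻¹ : ∀ α x → act α (x ⁻¹) ≈ act α x ⁻¹
  act-⁻¹ α x = inverseʳ-unique (act α x) (act α (x ⁻¹)) (begin
    act α x ∙ act α (x ⁻¹)  ≈⟨ act-hom α x (x ⁻¹) ⟨
    act α (x ∙ x ⁻¹)        ≈⟨ act-cong α (inverseʳ x) ⟩
    act α ε                 ≈⟨ act-ε α ⟩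
    ε                       ∎)

  act-cancelʳ : ∀ {α β x} → ¬ x ≈ ε → act α x ≈ act β x → α ≡ β
  act-cancelʳ {α} {β} {x} x≉ε αx≈βx with fpf α β x αx≈βx
  ... | inj₁ α≡β = α≡β
  ... | inj₂ x≈ε = ⊥-elim (x≉ε x≈ε)

  act-injective : ∀ {α x y} → α ≢ 𝟘 → act α x ≈ act α y → x ≈ y
  act-injective {α} {x} {y} α≢𝟘 αx≈αy with inv α α≢𝟘
  ... | β , _ , βα≈id , _ = begin
    x                ≈⟨ βα≈id x ⟨
    act β (act α x)  ≈⟨ act-cong β αx≈αy ⟩
    act β (act α y)  ≈⟨ βα≈id y ⟩
    y                ∎

  module _ (em : ExcludedMiddle 0ℓ) where

    compose : ∀ α β → ∃ λ γ → ∀ x → act γ x ≈ act α (act β x)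
    compose α β with em {α ≡ 𝟘} | em {β ≡ 𝟘}
    ... | yes ≡.refl | _ = 𝟘 , λ x → trans (act-𝟘 x) (sym (act-𝟘 (act β x)))
    ... | no _ | yes ≡.refl = 𝟘 , λ x → trans (act-𝟘 x) (sym (trans (act-cong α (act-𝟘 x)) (act-ε α)))
    ... | no α≢𝟘 | no β≢𝟘 with comp α β α≢𝟘 β≢𝟘
    ...   | γ , _ , γ≈αβ = γ , γ≈αβ

    negate : ∀ α → ∃ λ α′ → ∀ x → act α′ x ≈ act α x ⁻¹
    negate α with compose m𝟙 α
    ... | α′ , α′≈m𝟙α = α′ , λ x → trans (α′≈m𝟙α x) (act-m𝟙 (act α x))

    act-divide : ∀ {δ θ u v} → δ ≢ 𝟘 → act δ u ≈ act θ v → ∃ λ μ → u ≈ act μ v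
    act-divide {δ} {θ} {u} {v} δ≢𝟘 δu≈θv with inv δ δ≢𝟘
    ... | δ⁻¹ , _ , δ⁻¹δ≈id , _ with compose δ⁻¹ θ
    ...   | μ , μ≈δ⁻¹θ = μ , (begin
      u                  ≈⟨ δ⁻¹δ≈id u ⟨
      act δ⁻¹ (act δ u)  ≈⟨ act-cong δ⁻¹ δu≈θv ⟩
      act δ⁻¹ (act θ v)  ≈⟨ μ≈δ⁻¹θ v ⟨
      act μ v            ∎)

    InQ-difference : ∀ {u} → InQ act u → ∀ α β → ∃ λ δ → act α u ∙ act β u ⁻¹ ≈ act δ u
    InQ-difference {u} u∈Q α β with negate β
    ... | β′ , β′≈-β with u∈Q α β′
    ...   | δ , αu+β′u≈δu = δ , trans (∙-cong refl (sym (β′≈-β u))) αu+β′u≈δu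

module CommutativeFGroupProperties
  {G : Group 0ℓ 0ℓ} {Φ : Set} {act : Φ → Group.Carrier G → Group.Carrier G} {𝟘 𝟙 m𝟙 : Φ}
  (isFGroup : NVS.IsFGroup G Φ act 𝟘 𝟙 m𝟙) (em : ExcludedMiddle 0ℓ)
  (commutative : NVS.IsCommutative G act) where

  open Group G
  open NVS G
  open IsFGroup isFGroup
  open FGroupProperties isFGroup
  open import Algebra.Properties.AbelianGroup abelianGroup using (x∙y⁻¹≈ε⇒x≈y; ⁻¹-involutive)
  open import Algebra.Properties.CommutativeSemigroup (AbelianGroup.commutativeSemigroup abelianGroup)
    using (interchange)
  open import Relation.Binary.Reasoning.Setoid setoid

  InheritsSums : Carrier → Carrier → Set
  InheritsSums u v = ∀ {α β γ} → SumRel v α β γ → SumRel u α β γ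

  scalar-inheritsSums : ∀ {u v μ} → u ≈ act μ v → InheritsSums u v
  scalar-inheritsSums {u} {v} {μ} u≈μv {α} {β} {γ} v-sum = begin
    act α u ∙ act β u                  ≈⟨ ∙-cong (act-cong α u≈μv) (act-cong β u≈μv) ⟩
    act α (act μ v) ∙ act β (act μ v)  ≈⟨ ∙-cong (commutative α μ v) (commutative β μ v) ⟩
    act μ (act α v) ∙ act μ (act β v)  ≈⟨ act-hom μ (act α v) (act β v) ⟨
    act μ (act α v ∙ act β v)          ≈⟨ act-cong μ v-sum ⟩
    act μ (act γ v)                    ≈⟨ commutative μ γ v ⟩
    act γ (act μ v)                    ≈⟨ act-cong γ u≈μv ⟨
    act γ u                            ∎

  InQ-⁻¹ : ∀ {x} → InQ act (x ⁻¹) → InQ act x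
  InQ-⁻¹ {x} x⁻¹∈Q α β with x⁻¹∈Q α β
  ... | γ , x⁻¹-sum = γ , scalar-inheritsSums x≈-x⁻¹ x⁻¹-sum
    where
    x≈-x⁻¹ : x ≈ act m𝟙 (x ⁻¹)
    x≈-x⁻¹ = trans (sym (⁻¹-involutive x)) (sym (act-m𝟙 (x ⁻¹)))

  x∙y≈z∙w⇒x∙z⁻¹≈w∙y⁻¹ : ∀ x y z w → x ∙ y ≈ z ∙ w → x ∙ z ⁻¹ ≈ w ∙ y ⁻¹
  x∙y≈z∙w⇒x∙z⁻¹≈w∙y⁻¹ x y z w xy≈zw = begin
    x ∙ z ⁻¹                  ≈⟨ identityʳ _ ⟨
    (x ∙ z ⁻¹) ∙ ε            ≈⟨ ∙-cong refl (inverseʳ y) ⟨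
    (x ∙ z ⁻¹) ∙ (y ∙ y ⁻¹)   ≈⟨ interchange x (z ⁻¹) y (y ⁻¹) ⟩
    (x ∙ y) ∙ (z ⁻¹ ∙ y ⁻¹)   ≈⟨ ∙-cong xy≈zw refl ⟩
    (z ∙ w) ∙ (z ⁻¹ ∙ y ⁻¹)   ≈⟨ interchange z w (z ⁻¹) (y ⁻¹) ⟩
    (z ∙ z ⁻¹) ∙ (w ∙ y ⁻¹)   ≈⟨ ∙-cong (inverseʳ z) refl ⟩
    ε ∙ (w ∙ y ⁻¹)            ≈⟨ identityˡ _ ⟩
    w ∙ y ⁻¹                  ∎

  combination-sum : ∀ {u v l α β γu γv γw} →
                    SumRel u α β γu → SumRel v α β γv → SumRel (u ∙ act l v) α β γw →
                    act γu u ∙ act l (act γv v) ≈ act γw u ∙ act l (act γw v)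
  combination-sum {u} {v} {l} {α} {β} {γu} {γv} {γw} u-sum v-sum w-sum = begin
    act γu u ∙ act l (act γv v)
      ≈⟨ ∙-cong u-sum (act-cong l v-sum) ⟨
    (act α u ∙ act β u) ∙ act l (act α v ∙ act β v)
      ≈⟨ ∙-cong refl (act-hom l (act α v) (act β v)) ⟩
    (act α u ∙ act β u) ∙ (act l (act α v) ∙ act l (act β v))
      ≈⟨ interchange (act α u) (act β u) (act l (act α v)) (act l (act β v)) ⟩
    (act α u ∙ act l (act α v)) ∙ (act β u ∙ act l (act β v))
      ≈⟨ ∙-cong (act-combination α) (act-combination β) ⟨
    act α (u ∙ act l v) ∙ act β (u ∙ act l v)
      ≈⟨ w-sum ⟩
    act γw (u ∙ act l v)
      ≈⟨ act-combination γw ⟩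
    act γw u ∙ act l (act γw v)  ∎
    where
    act-combination : ∀ θ → act θ (u ∙ act l v) ≈ act θ u ∙ act l (act θ v)
    act-combination θ = trans (act-hom θ u (act l v)) (∙-cong refl (commutative θ l v))

  -- Writing δ u = γu u − γw u and δ′ v = γw v − γ v, the sum relations of u, v and w = u + l v
  -- give δ u = l (δ′ v).  Either both sides vanish, and fixed-point-freeness gives
  -- γu = γw = γ, or δ ≠ 0 and u is a scalar multiple of v.
  compatible⇒inheritsSums : ∀ {u v} → Compatible act 𝟘 u v → InheritsSums u v
  compatible⇒inheritsSums {u} {v} ((u∈Q , u≉ε) , (v∈Q , v≉ε) , l , l≢𝟘 , w∈Q) {α} {β} {γ} v-sum
    with u∈Q α β | w∈Q α β
  ... | γu , u-sum | γw , w-sum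
    with InQ-difference em u∈Q γu γw | InQ-difference em v∈Q γw γ
  ... | δ , δu-def | δ′ , δ′v-def = conclude em
    where
    δu≈lδ′v : act δ u ≈ act l (act δ′ v)
    δu≈lδ′v = begin
      act δ u                                ≈⟨ δu-def ⟨
      act γu u ∙ act γw u ⁻¹                 ≈⟨ x∙y≈z∙w⇒x∙z⁻¹≈w∙y⁻¹ _ _ _ _ (combination-sum u-sum v-sum w-sum) ⟩
      act l (act γw v) ∙ act l (act γ v) ⁻¹  ≈⟨ ∙-cong refl (act-⁻¹ l (act γ v)) ⟨
      act l (act γw v) ∙ act l (act γ v ⁻¹)  ≈⟨ act-hom l (act γw v) (act γ v ⁻¹) ⟨
      act l (act γw v ∙ act γ v ⁻¹)          ≈⟨ act-cong l δ′v-def ⟩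
      act l (act δ′ v)                       ∎

    conclude : Dec (δ ≡ 𝟘) → SumRel u α β γ
    conclude (yes δ≡𝟘) = trans u-sum (trans γu-u≈γw-u (reflexive (≡.cong (λ θ → act θ u) γw≡γ)))
      where
      δu≈ε : act δ u ≈ ε
      δu≈ε = trans (reflexive (≡.cong (λ θ → act θ u) δ≡𝟘)) (act-𝟘 u)
      γu-u≈γw-u : act γu u ≈ act γw u
      γu-u≈γw-u = x∙y⁻¹≈ε⇒x≈y _ _ (trans δu-def δu≈ε)
      δ′v≈ε : act δ′ v ≈ ε
      δ′v≈ε = act-injective l≢𝟘 (trans (sym δu≈lδ′v) (trans δu≈ε (sym (act-ε l))))
      γw≡γ : γw ≡ γ
      γw≡γ = act-cancelʳ v≉ε (x∙y⁻¹≈ε⇒x≈y _ _ (trans δ′v-def δ′v≈ε))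
    conclude (no δ≢𝟘) with compose em l δ′
    ... | θ , θ≈lδ′ with act-divide em δ≢𝟘 (trans δu≈lδ′v (sym (θ≈lδ′ v)))
    ...   | μ , u≈μv = scalar-inheritsSums u≈μv v-sum

module BlockDecomposition
  {G : Group 0ℓ 0ℓ} {Φ : Set} {act : Φ → Group.Carrier G → Group.Carrier G} {𝟘 𝟙 m𝟙 : Φ}
  (isFGroup : NVS.IsFGroup G Φ act 𝟘 𝟙 m𝟙) (em : ExcludedMiddle 0ℓ)
  (commutative : NVS.IsCommutative G act) (generated : NVS.Generates G (NVS.InQ G act))
  {m : ℕ} (blocks : NVS.HasBlocks G act 𝟘 m) where

  open Group G
  open NVS G
  open IsFGroup isFGroup
  open FGroupProperties isFGroup
  open CommutativeFGroupProperties isFGroup em commutative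
  open import Algebra.Properties.CommutativeMonoid.Sum (AbelianGroup.commutativeMonoid abelianGroup)
    using (sum; sum-replicate-zero; ∑-distrib-+)
  open import Algebra.Properties.CommutativeSemigroup (AbelianGroup.commutativeSemigroup abelianGroup)
    using (interchange)
  open import Relation.Binary.Reasoning.Setoid setoid

  private
    representative : Fin m → Carrier
    representative = proj₁ blocks

    representative∈Q : ∀ j → InQ act (representative j)
    representative∈Q j = proj₁ (proj₁ (proj₂ blocks) j)

    representatives-cover : ∀ q → InQ act q → ¬ q ≈ ε → ∃ λ j → Compatible act 𝟘 q (representative j)
    representatives-cover = proj₂ (proj₂ (proj₂ blocks))

  blockSum : Fin m → Φ → Φ → Φ
  blockSum j α β = proj₁ (representative∈Q j α β)

  RespectsBlockSums : Fin m → Carrier → Set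
  RespectsBlockSums j q = ∀ α β → SumRel q α β (blockSum j α β)

  respectsBlockSums-resp : ∀ {j x y} → x ≈ y → RespectsBlockSums j x → RespectsBlockSums j y
  respectsBlockSums-resp {j} x≈y x-sums α β =
    trans (∙-cong (act-cong α (sym x≈y)) (act-cong β (sym x≈y))) (trans (x-sums α β) (act-cong _ x≈y))

  respectsBlockSums-ε : ∀ {j} → RespectsBlockSums j ε
  respectsBlockSums-ε α β = trans (∙-cong (act-ε α) (act-ε β)) (trans (identityˡ ε) (sym (act-ε _)))

  respectsBlockSums-∙ : ∀ {j x y} → RespectsBlockSums j x → RespectsBlockSums j y → RespectsBlockSums j (x ∙ y)
  respectsBlockSums-∙ {j} {x} {y} x-sums y-sums α β = begin
    act α (x ∙ y) ∙ act β (x ∙ y)              ≈⟨ ∙-cong (act-hom α x y) (act-hom β x y) ⟩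
    (act α x ∙ act α y) ∙ (act β x ∙ act β y)  ≈⟨ interchange (act α x) (act α y) (act β x) (act β y) ⟩
    (act α x ∙ act β x) ∙ (act α y ∙ act β y)  ≈⟨ ∙-cong (x-sums α β) (y-sums α β) ⟩
    act γ x ∙ act γ y                          ≈⟨ act-hom γ x y ⟨
    act γ (x ∙ y)                              ∎
    where γ = blockSum j α β

  InQ⇒≈ε⊎respectsBlockSums : ∀ {q} → InQ act q → q ≈ ε ⊎ ∃ λ j → RespectsBlockSums j q
  InQ⇒≈ε⊎respectsBlockSums {q} q∈Q with em {q ≈ ε}
  ... | yes q≈ε = inj₁ q≈ε
  ... | no q≉ε with representatives-cover q q∈Q q≉ε
  ...   | j , q~uj = inj₂ (j , λ α β → compatible⇒inheritsSums q~uj (proj₂ (representative∈Q j α β)))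

  Decomposition : Carrier → Set
  Decomposition v = Σ (Vector Carrier m) λ w → (∀ j → RespectsBlockSums j (w j)) × sum w ≈ v

  decomposition-resp : ∀ {x y} → x ≈ y → Decomposition x → Decomposition y
  decomposition-resp x≈y (w , w-sums , sum≈x) = w , w-sums , trans sum≈x x≈y

  decomposition-ε : Decomposition ε
  decomposition-ε = replicate m ε , (λ j → respectsBlockSums-ε) , sum-replicate-zero m

  decomposition-∙ : ∀ {x y} → Decomposition x → Decomposition y → Decomposition (x ∙ y)
  decomposition-∙ (w , w-sums , sum-w≈x) (w′ , w′-sums , sum-w′≈y) =
    (λ j → w j ∙ w′ j) ,
    (λ j → respectsBlockSums-∙ (w-sums j) (w′-sums j)) ,
    trans (∑-distrib-+ w w′) (∙-cong sum-w≈x sum-w′≈y)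

  sum-updateAt-replicate-ε : ∀ {n} (j : Fin n) x → sum (updateAt (replicate n ε) j (const x)) ≈ x
  sum-updateAt-replicate-ε {suc n} zero    x = trans (∙-cong refl (sum-replicate-zero n)) (identityʳ x)
  sum-updateAt-replicate-ε {suc n} (suc j) x = trans (identityˡ _) (sum-updateAt-replicate-ε j x)

  decomposition-single : ∀ {j x} → RespectsBlockSums j x → Decomposition x
  decomposition-single {j} {x} x-sums = w , w-sums , sum-updateAt-replicate-ε j x
    where
    w : Vector Carrier m
    w = updateAt (replicate m ε) j (const x)

    w-sums : ∀ k → RespectsBlockSums k (w k)
    w-sums k with k ≟ j
    ... | yes ≡.refl = respectsBlockSums-resp (sym (reflexive (updateAt-updates j (replicate m ε)))) x-sums
    ... | no k≢j     = respectsBlockSums-resp (sym (reflexive (updateAt-minimal k j (replicate m ε) k≢j)))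
                                               respectsBlockSums-ε

  InQ⇒decomposition : ∀ {q} → InQ act q → Decomposition q
  InQ⇒decomposition q∈Q with InQ⇒≈ε⊎respectsBlockSums q∈Q
  ... | inj₁ q≈ε        = decomposition-resp (sym q≈ε) decomposition-ε
  ... | inj₂ (j , q-sums) = decomposition-single q-sums

  decomposition-foldr : ∀ {xs} → All (λ x → InQ act x ⊎ InQ act (x ⁻¹)) xs → Decomposition (foldr _∙_ ε xs)
  decomposition-foldr []                     = decomposition-ε
  decomposition-foldr (inj₁ x∈Q   ∷ gens) = decomposition-∙ (InQ⇒decomposition x∈Q) (decomposition-foldr gens)
  decomposition-foldr (inj₂ x⁻¹∈Q ∷ gens) =
    decomposition-∙ (InQ⇒decomposition (InQ-⁻¹ x⁻¹∈Q)) (decomposition-foldr gens)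

  decompose : ∀ v → Decomposition v
  decompose v with generated v
  ... | xs , gens , product≈v = decomposition-resp product≈v (decomposition-foldr gens)

  component : Carrier → Vector Carrier m
  component v = proj₁ (decompose v)

  component-respects : ∀ v j → RespectsBlockSums j (component v j)
  component-respects v = proj₁ (proj₂ (decompose v))

  sum-component : ∀ v → sum (component v) ≈ v
  sum-component v = proj₂ (proj₂ (decompose v))

module UltrapowerProperties
  {G : Group 0ℓ 0ℓ} {I : Set} (𝓤 : Ultrafilter I)
  {Φ : Set} {act : Φ → Group.Carrier G → Group.Carrier G} {𝟘 𝟙 m𝟙 : Φ}
  (isFGroup : NVS.IsFGroup G Φ act 𝟘 𝟙 m𝟙) where

  open Group G
  open NVS G
  open IsFGroup isFGroup
  open Ultrafilter 𝓤
  open UltrafilterProperties 𝓤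
  open FGroupProperties isFGroup using (SumRel; act-cancelʳ)
  open import Algebra.Properties.Monoid.Sum monoid using (sum)

  private
    Gᴵ = Ultrapower.group G 𝓤
    actᴵ = Ultrapower.liftAct G 𝓤 act
    module Gᴵ = Group Gᴵ

  isFGroupᴵ : NVS.IsFGroup Gᴵ Φ actᴵ 𝟘 𝟙 m𝟙
  isFGroupᴵ = record
    { act-cong = λ α → U-mono (λ i → act-cong α)
    ; act-hom  = λ α f g → U-everywhere (λ i → act-hom α (f i) (g i))
    ; act-inj  = λ α β αf≈βf → act-inj α β (λ x → proj₂ (U-proper (αf≈βf (const x))))
    ; act-𝟘    = λ f → U-everywhere (λ i → act-𝟘 (f i))
    ; act-𝟙    = λ f → U-everywhere (λ i → act-𝟙 (f i))
    ; act-m𝟙   = λ f → U-everywhere (λ i → act-m𝟙 (f i))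
    ; 𝟙≢𝟘      = 𝟙≢𝟘
    ; comp     = compᴵ
    ; inv      = invᴵ
    ; fpf      = fpfᴵ
    }
    where
    compᴵ : ∀ α β → α ≢ 𝟘 → β ≢ 𝟘 → ∃ λ γ → γ ≢ 𝟘 × (∀ f → Gᴵ._≈_ (actᴵ γ f) (actᴵ α (actᴵ β f)))
    compᴵ α β α≢𝟘 β≢𝟘 with comp α β α≢𝟘 β≢𝟘
    ... | γ , γ≢𝟘 , γ≈αβ = γ , γ≢𝟘 , λ f → U-everywhere (λ i → γ≈αβ (f i))

    invᴵ : ∀ α → α ≢ 𝟘 → ∃ λ β → β ≢ 𝟘 × (∀ f → Gᴵ._≈_ (actᴵ β (actᴵ α f)) f)
                                        × (∀ f → Gᴵ._≈_ (actᴵ α (actᴵ β f)) f)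
    invᴵ α α≢𝟘 with inv α α≢𝟘
    ... | β , β≢𝟘 , βα≈id , αβ≈id =
      β , β≢𝟘 , (λ f → U-everywhere (λ i → βα≈id (f i))) , (λ f → U-everywhere (λ i → αβ≈id (f i)))

    fpfᴵ : ∀ α β f → Gᴵ._≈_ (actᴵ α f) (actᴵ β f) → α ≡ β ⊎ Gᴵ._≈_ f Gᴵ.ε
    fpfᴵ α β f αf≈βf with U-ultra (λ i → f i ≈ ε)
    ... | inj₁ f≈ε = inj₂ f≈ε
    ... | inj₂ f≉ε with U-proper (U-∩ αf≈βf f≉ε)
    ...   | i , αfi≈βfi , fi≉ε = inj₁ (act-cancelʳ fi≉ε αfi≈βfi)

  UniformlyInQ : (I → Carrier) → Set
  UniformlyInQ f = ∀ α β → ∃ λ γ → ∀ i → SumRel (f i) α β γ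

  uniformlyInQ⇒InQ : ∀ {f} → UniformlyInQ f → NVS.InQ Gᴵ actᴵ f
  uniformlyInQ⇒InQ f-uniform α β with f-uniform α β
  ... | γ , f-sums = γ , U-everywhere f-sums

  foldr-tabulate : ∀ {n} (g : Fin n → I → Carrier) i → foldr Gᴵ._∙_ Gᴵ.ε (tabulate g) i ≡ sum (λ j → g j i)
  foldr-tabulate {zero}  g i = ≡.refl
  foldr-tabulate {suc n} g i = ≡.cong (g zero i ∙_) (foldr-tabulate (λ j → g (suc j)) i)

  generatedᴵ : ∀ m → (∀ f → ∃ λ (g : Fin m → I → Carrier) → (∀ j → UniformlyInQ (g j))
                                                            × (∀ i → sum (λ j → g j i) ≈ f i)) →
               NVS.Generates Gᴵ (NVS.InQ Gᴵ actᴵ)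
  generatedᴵ m uniform-sums f with uniform-sums f
  ... | g , g-uniform , sum≈f =
    tabulate g ,
    tabulate⁺ (λ j → inj₁ (uniformlyInQ⇒InQ (g-uniform j))) ,
    U-everywhere (λ i → trans (reflexive (foldr-tabulate g i)) (sum≈f i))

mainTheorem9 : (G : Group 0ℓ 0ℓ) (Φ : Set) (act : Φ → Group.Carrier G → Group.Carrier G) (𝟘 𝟙 m𝟙 : Φ) →
    NVS.IsNearVectorSpace G Φ act 𝟘 𝟙 m𝟙 →
    NVS.IsCommutative G act →
    (m : ℕ) → NVS.HasBlocks G act 𝟘 m →
    (I : Set) (𝓤 : Ultrafilter I) →
    NVS.IsNearVectorSpace (Ultrapower.group G 𝓤) Φ (Ultrapower.liftAct G 𝓤 act) 𝟘 𝟙 m𝟙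
mainTheorem9 G Φ act 𝟘 𝟙 m𝟙 isNVS commutative m blocks I 𝓤 = record
  { isFGroup  = isFGroupᴵ
  ; generated = generatedᴵ m (λ f →
      (λ j i → component (f i) j) ,
      (λ j α β → blockSum j α β , λ i → component-respects (f i) j α β) ,
      (λ i → sum-component (f i)))
  }
  where
  open NVS.IsNearVectorSpace isNVS
  open UltrafilterProperties 𝓤 using (excludedMiddle)
  open BlockDecomposition isFGroup excludedMiddle commutative generated blocks
  open UltrapowerProperties 𝓤 isFGroup
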